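{- Let $n,r,k$ be positive integers. If there exists a colour pattern $G_1,\ldots,G_r$ on an $n$-element vertex set in which each $G_i$ is $(n,r,k)$-critical, then $P_r(k) \leq n$.
   Context: All graphs are finite and simple; $K_k$ denotes the complete graph on $k$ vertices. A colour pattern on a vertex set $V$ is a sequence $G_1,\ldots,G_r$ of pairwise edge-disjoint graphs all with vertex set $V$; it is $K_{k+1}$-free if no $G_i$ contains $K_{k+1}$. Given a colour pattern $G_1,\dots,G_r$ on $V$ and a colouring $c:V\to[r]$, a strongly monochromatic $K_k$ is a set of $k$ vertices all of the same colour $i$ under $c$ which forms a clique in $G_i$. $P_r(k)$ is the smallest integer $n$ such that there exists a $K_{k+1}$-free colour pattern $G_1,\ldots,G_r$ on an $n$-element vertex set $V$ such that every colouring $V\to[r]$ contains a strongly monochromatic $K_k$. For a graph $F$, $\alpha_k(F)$ is the largest size of a vertex subset of $F$ containing no $K_k$. A graph $F$ on $n$ vertices is $(n,r,k)$-critical if $F$ contains no $K_{k+1}$ and $\alpha_k(F)<n/r$. -}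

module Defs where

open import Data.Nat using (ℕ; _*_; _<_; _≤_)
open import Data.Bool using (Bool; true; false)
open import Data.Fin using (Fin)
open import Data.Fin.Subset using (Subset; _∈_; ∣_∣)
open import Data.Product using (Σ; _×_; ∃)
open import Relation.Nullary using (¬_)
open import Relation.Binary.PropositionalEquality using (_≡_; _≢_)
open import Function.Definitions using (Injective)

record Graph (n : ℕ) : Set where
  field
    adj    : Fin n → Fin n → Bool
    sym    : ∀ u v → adj u v ≡ adj v u
    irrefl : ∀ u → adj u u ≡ false
open Graph public

IsClique : ∀ {n} → Graph n → (k : ℕ) → (Fin k → Fin n) → Set
IsClique F k f = Injective _≡_ _≡_ f × (∀ a b → a ≢ b → adj F (f a) (f b) ≡ true)

KFree : ∀ {n} → ℕ → Graph n → Set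
KFree m F = ¬ (Σ (Fin m → Fin _) λ f → IsClique F m f)

SubsetKFree : ∀ {n} → Graph n → ℕ → Subset n → Set
SubsetKFree F k S = ¬ (Σ (Fin k → Fin _) λ f → IsClique F k f × (∀ a → f a ∈ S))

-- α_k(F) < n / r, i.e. every K_k-free vertex subset S satisfies |S| < n/r, i.e. |S| * r < n.
AlphaLt : ∀ {n} → Graph n → (k r : ℕ) → Set
AlphaLt {n} F k r = ∀ (S : Subset n) → SubsetKFree F k S → ∣ S ∣ * r < n

Critical : ∀ {n} → ℕ → ℕ → Graph n → Set
Critical r k F = KFree (Data.Nat.suc k) F × AlphaLt F k r

ColourPattern : ℕ → ℕ → Set
ColourPattern r n = Fin r → Graph n

EdgeDisjoint : ∀ {r n} → ColourPattern r n → Set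
EdgeDisjoint G = ∀ i j → i ≢ j → ∀ u v → adj (G i) u v ≡ true → adj (G j) u v ≡ false

StronglyMonoK : ∀ {r n} → ColourPattern r n → (Fin n → Fin r) → ℕ → Set
StronglyMonoK G c k = Σ (Fin _) λ i → Σ (Fin k → Fin _) λ f →
  IsClique (G i) k f × (∀ a → c (f a) ≡ i)

Witness : (r k m : ℕ) → Set
Witness r k m = Σ (ColourPattern r m) λ G →
  EdgeDisjoint G × (∀ i → KFree (Data.Nat.suc k) (G i)) ×
  (∀ (c : Fin m → Fin r) → StronglyMonoK G c k)

-- P_r(k) ≤ n : the least m with Witness r k m is at most n,
-- i.e. some m ≤ n has Witness r k m.
P≤ : (r k n : ℕ) → Set
P≤ r k n = Σ ℕ λ m → m ≤ n × Witness r k m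

-- The given pattern is itself a witness. Under any colouring of the n vertices with r
-- colours some colour class S_i has at least n/r vertices, while criticality of G_i says
-- that every K_k-free vertex set of G_i has fewer than n/r vertices. Hence S_i contains a
-- K_k of G_i, which is strongly monochromatic. Criticality only refutes the absence of
-- such a clique; an actual clique is obtained by exhaustive search.
module Submission where

open import Defs hiding (sym)
open import Data.Bool using (true; if_then_else_)
open import Data.Bool.Properties using () renaming (_≟_ to _≟ᵇ_)
open import Data.Fin using (Fin; zero; suc)
open import Data.Fin.Properties using (any?; all?; _≟_)
open import Data.Fin.Subset using (Subset; _∈_; ∣_∣; inside; outside)
open import Data.Fin.Subset.Properties using (_∈?_)
open import Data.Nat using (ℕ; zero; suc; _+_; _*_; _≤_; _<_; _≥_; z≤n; NonZero; >-nonZero)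
open import Data.Nat.Properties
  using (+-*-semiring; _≤?_; ≤-refl; <⇒≤; <⇒≢; ≤⇒≯; ≰⇒>; *-comm; +-mono-≤; +-mono-<-≤;
         *-cancelʳ-<; module ≤-Reasoning)
open import Data.Product using (Σ; ∃; _×_; _,_; proj₁; proj₂)
open import Data.Vec using (_∷_; tabulate)
open import Data.Vec.Functional using (head; tail) renaming (_∷_ to _∷ᶠ_)
open import Data.Vec.Functional.Properties using (∷-cong)
open import Data.Vec.Properties using (lookup∘tabulate; []=⇒lookup)
open import Function using (_∘_)
open import Relation.Binary.Definitions using (_Respects_)
open import Relation.Binary.PropositionalEquality
open import Relation.Nullary using (Dec; does; yes; no; contradiction)
open import Relation.Nullary.Decidable using (map′; _×-dec_; _→-dec_; ¬?)
open import Relation.Unary using (Pred; Decidable)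

open import Algebra.Properties.Semiring.Sum +-*-semiring
  using (sum; sum-syntax; sum-cong-≗; sum-replicate-zero; ∑-distrib-+; *-distribʳ-sum)

∃-function? : ∀ {k n p} {P : Pred (Fin k → Fin n) p} →
              P Respects _≗_ → Decidable P → Dec (∃ P)
∃-function? {zero} P-resp P? = map′ (_ ,_) (λ (f , p) → P-resp (λ ()) p) (P? (λ ()))
∃-function? {suc k} P-resp P? =
  map′ (λ (x , g , p) → x ∷ᶠ g , p)
       (λ (f , p) → head f , tail f , P-resp (∷-cong refl (λ _ → refl)) p)
       (any? λ x → ∃-function? (λ g≗h → P-resp (∷-cong refl g≗h)) (λ g → P? (x ∷ᶠ g)))

module _ {n} (F : Graph n) (k : ℕ) where

  IsClique-resp : IsClique F k Respects _≗_
  IsClique-resp f≗g (injective , adjacent) =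
      (λ {a} {b} ga≡gb → injective (trans (f≗g a) (trans ga≡gb (sym (f≗g b)))))
    , (λ a b a≢b → subst₂ (λ u v → adj F u v ≡ true) (f≗g a) (f≗g b) (adjacent a b a≢b))

  isClique? : Decidable (IsClique F k)
  isClique? f = injective? ×-dec adjacent?
    where
    injective? = map′ (λ inj {a} {b} → inj a b) (λ inj a b → inj {a} {b})
                      (all? λ a → all? λ b → (f a ≟ f b) →-dec (a ≟ b))
    adjacent?  = all? λ a → all? λ b → ¬? (a ≟ b) →-dec (adj F (f a) (f b) ≟ᵇ true)

  CliqueIn : Subset n → (Fin k → Fin n) → Set
  CliqueIn S f = IsClique F k f × (∀ a → f a ∈ S)

  cliqueIn? : (S : Subset n) → Dec (∃ (CliqueIn S))
  cliqueIn? S = ∃-function? CliqueIn-resp (λ f → isClique? f ×-dec all? (λ a → f a ∈? S))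
    where
    CliqueIn-resp : CliqueIn S Respects _≗_
    CliqueIn-resp f≗g (clique , inS) =
      IsClique-resp f≗g clique , λ a → subst (_∈ S) (f≗g a) (inS a)

  AlphaLt⇒cliqueIn : ∀ {r} → AlphaLt F k r → (S : Subset n) → n ≤ ∣ S ∣ * r → ∃ (CliqueIn S)
  AlphaLt⇒cliqueIn α<n/r S large with cliqueIn? S
  ... | yes clique = clique
  ... | no  free   = contradiction (α<n/r S free) (≤⇒≯ large)

∑-const : ∀ r m → ∑[ i < r ] m ≡ r * m
∑-const zero    m = refl
∑-const (suc r) m = cong (m +_) (∑-const r m)

∑-mono-≤ : ∀ {r} {f g : Fin r → ℕ} → (∀ i → f i ≤ g i) → sum f ≤ sum g
∑-mono-≤ {zero}  f≤g = z≤n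
∑-mono-≤ {suc r} f≤g = +-mono-≤ (f≤g zero) (∑-mono-≤ (f≤g ∘ suc))

∑-mono-< : ∀ {r} .{{_ : NonZero r}} {f g : Fin r → ℕ} → (∀ i → f i < g i) → sum f < sum g
∑-mono-< {suc r} f<g = +-mono-<-≤ (f<g zero) (∑-mono-≤ (<⇒≤ ∘ f<g ∘ suc))

∀*<⇒∑< : ∀ {r} .{{_ : NonZero r}} (f : Fin r → ℕ) {m} → (∀ i → f i * r < m) → sum f < m
∀*<⇒∑< {r} f {m} f*r<m = *-cancelʳ-< r (sum f) m (begin-strict
  sum f * r             ≡⟨ *-distribʳ-sum r f ⟩
  ∑[ i < r ] (f i * r)  <⟨ ∑-mono-< f*r<m ⟩
  ∑[ i < r ] m          ≡⟨ ∑-const r m ⟩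
  r * m                 ≡⟨ *-comm r m ⟩
  m * r                 ∎)
  where open ≤-Reasoning

colourClass : ∀ {n r} → (Fin n → Fin r) → Fin r → Subset n
colourClass c i = tabulate λ v → does (c v ≟ i)

∈-colourClass⇒ : ∀ {n r} {c : Fin n → Fin r} {i v} → v ∈ colourClass c i → c v ≡ i
∈-colourClass⇒ {c = c} {i} {v} v∈S
  with c v ≟ i | trans (sym (lookup∘tabulate (λ u → does (c u ≟ i)) v)) ([]=⇒lookup v∈S)
... | yes cv≡i | _  = cv≡i
... | no  _    | ()

∣x∷p∣≡[x]+∣p∣ : ∀ {n} x (p : Subset n) → ∣ x ∷ p ∣ ≡ (if x then 1 else 0) + ∣ p ∣
∣x∷p∣≡[x]+∣p∣ inside  p = refl
∣x∷p∣≡[x]+∣p∣ outside p = refl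

∑-indicator≡1 : ∀ {r} (j : Fin r) → ∑[ i < r ] (if does (j ≟ i) then 1 else 0) ≡ 1
∑-indicator≡1 {suc r} zero    = cong suc (sum-replicate-zero r)
∑-indicator≡1 {suc r} (suc j) = ∑-indicator≡1 j

∑-∣colourClass∣≡n : ∀ {n r} (c : Fin n → Fin r) → ∑[ i < r ] ∣ colourClass c i ∣ ≡ n
∑-∣colourClass∣≡n {zero}  {r} c = sum-replicate-zero r
∑-∣colourClass∣≡n {suc n} {r} c = begin
  ∑[ i < r ] ∣ colourClass c i ∣
    ≡⟨ sum-cong-≗ (λ i → ∣x∷p∣≡[x]+∣p∣ _ (colourClass (tail c) i)) ⟩
  ∑[ i < r ] ((if does (head c ≟ i) then 1 else 0) + ∣ colourClass (tail c) i ∣)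
    ≡⟨ ∑-distrib-+ (λ i → if does (head c ≟ i) then 1 else 0) (λ i → ∣ colourClass (tail c) i ∣) ⟩
  ∑[ i < r ] (if does (head c ≟ i) then 1 else 0) + ∑[ i < r ] ∣ colourClass (tail c) i ∣
    ≡⟨ cong₂ _+_ (∑-indicator≡1 (head c)) (∑-∣colourClass∣≡n (tail c)) ⟩
  suc n ∎
  where open ≡-Reasoning

largeColourClass : ∀ {n r} .{{_ : NonZero r}} (c : Fin n → Fin r) →
                   ∃ λ i → n ≤ ∣ colourClass c i ∣ * r
largeColourClass {n} {r} c with any? (λ i → n ≤? ∣ colourClass c i ∣ * r)
... | yes large = large
... | no  none  = contradiction (∑-∣colourClass∣≡n c)
  (<⇒≢ (∀*<⇒∑< (λ i → ∣ colourClass c i ∣) (λ i → ≰⇒> (λ large → none (i , large)))))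

AlphaLt⇒StronglyMonoK : ∀ {n r k} .{{_ : NonZero r}} (G : ColourPattern r n) →
  (∀ i → AlphaLt (G i) k r) → (c : Fin n → Fin r) → StronglyMonoK G c k
AlphaLt⇒StronglyMonoK {k = k} G α<n/r c =
  let i , large        = largeColourClass c
      f , clique , inS = AlphaLt⇒cliqueIn (G i) k (α<n/r i) (colourClass c i) large
  in  i , f , clique , ∈-colourClass⇒ {c = c} ∘ inS

lemma4p1 : (n r k : ℕ) → n ≥ 1 → r ≥ 1 → k ≥ 1 →
    (Σ (ColourPattern r n) λ G → EdgeDisjoint G × (∀ i → Critical r k (G i))) →
    P≤ r k n
lemma4p1 n r k _ r≥1 _ (G , disjoint , critical) =
  n , ≤-refl , G , disjoint , proj₁ ∘ critical ,
  AlphaLt⇒StronglyMonoK {{>-nonZero r≥1}} G (proj₂ ∘ critical)
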